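{- Let $a,b$ be coprime positive integers and $m$ a positive integer. Then $\mathcal{I}(a\cdot b,m)=\mathcal{I}(a,m)\cdot\mathcal{I}(b,m)$.
   Context: For a positive integer $n$, $\mathbb{Z}_n=\mathbb{Z}/n\mathbb{Z}$. Two points $(u_1,\dots,u_m),(v_1,\dots,v_m)\in\mathbb{Z}_n^m$ are at integral distance if there exists $d\in\mathbb{Z}_n$ with $\sum_{i=1}^m(u_i-v_i)^2=d^2$ in $\mathbb{Z}_n$. An integral point set over $\mathbb{Z}_n^m$ is a subset of $\mathbb{Z}_n^m$ whose points are pairwise at integral distance. $\mathcal{I}(n,m)$ denotes the maximum cardinality of an integral point set over $\mathbb{Z}_n^m$. -}

module Defs where

open import Data.Nat using (ℕ; _≤_)
open import Relation.Binary.PropositionalEquality using (_≡_)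
open import Data.Fin using (Fin; toℕ)
open import Data.Vec using (Vec; []; _∷_)
open import Data.Integer using (ℤ; +_; _+_; _-_; _*_)
open import Data.Integer.Divisibility using (_∣_)
open import Data.List using (List; length)
open import Data.List.Relation.Unary.AllPairs using (AllPairs)
open import Data.List.Relation.Unary.Unique.Propositional using (Unique)
open import Data.Product using (Σ; ∃; _×_)

-- Z_n is represented by Fin n (residues 0..n-1); a point of Z_n^m is a Vec (Fin n) m.
Point : ℕ → ℕ → Set
Point n m = Vec (Fin n) m

sqDist : ∀ {n m} → Point n m → Point n m → ℤ
sqDist []       []       = + 0
sqDist (u ∷ us) (v ∷ vs) = (+ toℕ u - + toℕ v) * (+ toℕ u - + toℕ v) + sqDist us vs

_≡[mod_]_ : ℤ → ℕ → ℤ → Set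
x ≡[mod n ] y = (+ n) ∣ (x - y)

IntegralDist : ∀ {n m} → Point n m → Point n m → Set
IntegralDist {n} u v = Σ (Fin n) λ d → sqDist u v ≡[mod n ] ((+ toℕ d) * (+ toℕ d))

IntegralPointSet : (n m : ℕ) → List (Point n m) → Set
IntegralPointSet n m S = Unique S × AllPairs IntegralDist S

-- k is the maximum cardinality of an integral point set over Z_n^m, i.e. k = I(n,m)
IsMaxIPS : (n m k : ℕ) → Set
IsMaxIPS n m k =
  (Σ (List (Point n m)) λ S → IntegralPointSet n m S × length S ≡ k)
  × (∀ (S : List (Point n m)) → IntegralPointSet n m S → length S ≤ k)

module Submission where

-- For coprime a, b the map x ↦ (x mod a, x mod b) identifies Z_{ab}^m with
-- Z_a^m × Z_b^m coordinatewise, and integral distance is compatible with it: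
--   * reducing modulo a divisor n of N preserves integral distance, because the squared
--     distance and the square d² are polynomials in the coordinates and in d;
--   * two pairs at integral distance over Z_a and over Z_b glue to a pair at integral
--     distance over Z_{ab}, since a congruence modulo a and modulo b is one modulo ab.
-- Lower bound: the CRT image of the product of maximal sets over Z_a and Z_b is an
-- integral point set of size ka·kb.  Upper bound: a set S over Z_{ab}^m injects, via its
-- two reductions, into the product of its reductions modulo a and modulo b, which are
-- integral point sets and so have at most ka and kb elements.

open import Defs
open import Data.Nat using (ℕ; _*_; NonZero)
open import Data.Nat.Coprimality using (Coprime)

import Data.Nat as ℕ
import Data.Nat.Properties as ℕP
import Data.Nat.Divisibility as ℕD
import Data.Nat.Coprimality as Coprimality
open import Data.Nat.GCD using (module Bézout)
open import Data.Integer using (ℤ; +_; ∣_∣)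
  renaming (_+_ to _+ᶻ_; _-_ to _-ᶻ_; _*_ to _*ᶻ_; -_ to -ᶻ_)
import Data.Integer.Properties as ℤP
import Data.Integer.DivMod as ℤD
import Data.Integer.Divisibility.Signed as Signed
open import Data.Integer.Tactic.RingSolver using (solve-∀)
open import Data.Fin using (Fin; toℕ; fromℕ<)
import Data.Fin.Properties as FinP
open import Data.Vec as Vec using ([]; _∷_; zipWith)
import Data.Vec.Properties as VecP
open import Data.Vec.Relation.Binary.Pointwise.Inductive as Pointwise
  using (Pointwise; []; _∷_; Pointwise-≡⇒≡)
open import Data.List
  using (List; []; _∷_; length; map; _++_; cartesianProductWith; cartesianProduct; deduplicate)
import Data.List.Properties as ListP
open import Data.List.Membership.Propositional using (_∈_)
open import Data.List.Membership.Propositional.Properties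
  using (∈-∃++; ∈-++⁻; ∈-++⁺ˡ; ∈-++⁺ʳ; ∈-map⁺; ∈-map⁻; ∈-deduplicate⁺; ∈-deduplicate⁻;
         ∈-cartesianProductWith⁻; ∈-cartesianProduct⁺)
open import Data.List.Relation.Unary.Any using (here; there)
import Data.List.Relation.Unary.All as All
open import Data.List.Relation.Unary.AllPairs using (AllPairs; []; _∷_)
open import Data.List.Relation.Unary.Unique.Propositional using (Unique)
import Data.List.Relation.Unary.Unique.Propositional.Properties as Unique
import Data.List.Relation.Unary.Unique.DecPropositional.Properties as DecUnique
open import Data.Product using (Σ; _×_; _,_; proj₁; proj₂)
open import Data.Sum using (inj₁; inj₂)
open import Data.Empty using (⊥-elim)
open import Function using (_∘_)
open import Relation.Binary.Bundles using (Setoid)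
open import Relation.Binary.Definitions using (DecidableEquality)
open import Relation.Binary.PropositionalEquality
  using (_≡_; refl; sym; trans; cong; cong₂; subst; module ≡-Reasoning)
import Relation.Binary.Reasoning.Setoid as SetoidReasoning

infix 4 _≈_[mod_]

-- x ≈ y [mod n ]: n divides x - y (signed divisibility, so that the witness is an
-- explicit quotient).  Unlike Defs._≡[mod_]_ it is a data type, so x and y are inferable.
data _≈_[mod_] (x y : ℤ) (n : ℕ) : Set where
  mod-by : + n Signed.∣ (x -ᶻ y) → x ≈ y [mod n ]

≈⇒≡[mod] : ∀ {n x y} → x ≈ y [mod n ] → x ≡[mod n ] y
≈⇒≡[mod] (mod-by n∣x-y) = Signed.∣⇒∣ᵤ n∣x-y

≡[mod]⇒≈ : ∀ {n x y} → x ≡[mod n ] y → x ≈ y [mod n ]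
≡[mod]⇒≈ n∣x-y = mod-by (Signed.∣ᵤ⇒∣ n∣x-y)

divides-difference : ∀ {n x y z} → + n Signed.∣ z → z ≡ x -ᶻ y → x ≈ y [mod n ]
divides-difference n∣z refl = mod-by n∣z

by-quotient : ∀ {n x y} q → x -ᶻ y ≡ q *ᶻ + n → x ≈ y [mod n ]
by-quotient q eq = mod-by (Signed.divides q eq)

≈-reflexive : ∀ {n x y} → x ≡ y → x ≈ y [mod n ]
≈-reflexive {n} {x} refl = by-quotient (+ 0) (ℤP.+-inverseʳ x)

≈-refl : ∀ {n x} → x ≈ x [mod n ]
≈-refl = ≈-reflexive refl

≈-sym : ∀ {n x y} → x ≈ y [mod n ] → y ≈ x [mod n ]
≈-sym {x = x} {y} (mod-by p) = divides-difference (Signed.∣m⇒∣-m p) (negated x y)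
  where
  negated : ∀ x y → -ᶻ (x -ᶻ y) ≡ y -ᶻ x
  negated = solve-∀

≈-trans : ∀ {n x y z} → x ≈ y [mod n ] → y ≈ z [mod n ] → x ≈ z [mod n ]
≈-trans {x = x} {y} {z} (mod-by p) (mod-by q) =
  divides-difference (Signed.∣m∣n⇒∣m+n p q) (telescope x y z)
  where
  telescope : ∀ x y z → (x -ᶻ y) +ᶻ (y -ᶻ z) ≡ x -ᶻ z
  telescope = solve-∀

≈-+ : ∀ {n x x' y y'} → x ≈ y [mod n ] → x' ≈ y' [mod n ] → x +ᶻ x' ≈ y +ᶻ y' [mod n ]
≈-+ {x = x} {x'} {y} {y'} (mod-by p) (mod-by q) =
  divides-difference (Signed.∣m∣n⇒∣m+n p q) (regroup x x' y y')
  where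
  regroup : ∀ x x' y y' → (x -ᶻ y) +ᶻ (x' -ᶻ y') ≡ (x +ᶻ x') -ᶻ (y +ᶻ y')
  regroup = solve-∀

≈-- : ∀ {n x x' y y'} → x ≈ y [mod n ] → x' ≈ y' [mod n ] → x -ᶻ x' ≈ y -ᶻ y' [mod n ]
≈-- {x = x} {x'} {y} {y'} (mod-by p) (mod-by q) =
  divides-difference (Signed.∣m∣n⇒∣m-n p q) (regroup x x' y y')
  where
  regroup : ∀ x x' y y' → (x -ᶻ y) -ᶻ (x' -ᶻ y') ≡ (x -ᶻ x') -ᶻ (y -ᶻ y')
  regroup = solve-∀

≈-* : ∀ {n x x' y y'} → x ≈ y [mod n ] → x' ≈ y' [mod n ] → x *ᶻ x' ≈ y *ᶻ y' [mod n ]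
≈-* {x = x} {x'} {y} {y'} (mod-by p) (mod-by q) =
  divides-difference (Signed.∣m∣n⇒∣m+n (Signed.∣n⇒∣m*n x q) (Signed.∣m⇒∣m*n y' p))
                     (product-difference x x' y y')
  where
  product-difference : ∀ x x' y y' → x *ᶻ (x' -ᶻ y') +ᶻ (x -ᶻ y) *ᶻ y' ≡ x *ᶻ x' -ᶻ y *ᶻ y'
  product-difference = solve-∀

≈-scale : ∀ {n y y'} x → y ≈ y' [mod n ] → x *ᶻ y ≈ x *ᶻ y' [mod n ]
≈-scale x = ≈-* (≈-refl {x = x})

≈-weaken : ∀ {k n x y} → k ℕD.∣ n → x ≈ y [mod n ] → x ≈ y [mod k ]
≈-weaken k∣n (mod-by p) = mod-by (Signed.∣-trans (Signed.∣ᵤ⇒∣ k∣n) p)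

coprime-product-∣ : ∀ {a b z} → Coprime a b → a ℕD.∣ z → b ℕD.∣ z → a * b ℕD.∣ z
coprime-product-∣ {a} {b} coprime (ℕD.divides q refl) b∣qa =
  subst (ℕD._∣ q * a) (ℕP.*-comm b a) (ℕD.*-monoˡ-∣ a b∣q)
  where
  b∣q : b ℕD.∣ q
  b∣q = Coprimality.coprime-divisor (Coprimality.sym coprime) (subst (b ℕD.∣_) (ℕP.*-comm q a) b∣qa)

≈-combine : ∀ {a b x y} → Coprime a b → x ≈ y [mod a ] → x ≈ y [mod b ] → x ≈ y [mod a * b ]
≈-combine coprime (mod-by p) (mod-by q) =
  mod-by (Signed.∣ᵤ⇒∣ (coprime-product-∣ coprime (Signed.∣⇒∣ᵤ p) (Signed.∣⇒∣ᵤ q)))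

≈-setoid : ℕ → Setoid _ _
≈-setoid n = record
  { Carrier       = ℤ
  ; _≈_           = _≈_[mod n ]
  ; isEquivalence = record { refl = ≈-refl ; sym = ≈-sym ; trans = ≈-trans }
  }

module ≈-Reasoning (n : ℕ) = SetoidReasoning (≈-setoid n)

crt-idempotent : ∀ {a b} → Coprime a b → Σ ℤ λ e → e ≈ + 1 [mod a ] × e ≈ + 0 [mod b ]
crt-idempotent {a} {b} coprime with Coprimality.coprime-Bézout coprime
... | Bézout.+- x y 1+yb≡xa =
  -ᶻ + (y * b) , by-quotient (-ᶻ + x) e-1≡-xa , by-quotient (-ᶻ + y) e≡-yb
  where
  open ≡-Reasoning
  shift : ∀ p → -ᶻ p -ᶻ + 1 ≡ -ᶻ (+ 1 +ᶻ p)
  shift = solve-∀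
  e-1≡-xa : -ᶻ + (y * b) -ᶻ + 1 ≡ -ᶻ + x *ᶻ + a
  e-1≡-xa = begin
    -ᶻ + (y * b) -ᶻ + 1      ≡⟨ shift (+ (y * b)) ⟩
    -ᶻ (+ 1 +ᶻ + (y * b))    ≡⟨ cong -ᶻ_ (ℤP.pos-+ 1 (y * b)) ⟨
    -ᶻ + (1 ℕ.+ y * b)       ≡⟨ cong (-ᶻ_ ∘ +_) 1+yb≡xa ⟩
    -ᶻ + (x * a)             ≡⟨ cong -ᶻ_ (ℤP.pos-* x a) ⟩
    -ᶻ (+ x *ᶻ + a)          ≡⟨ ℤP.neg-distribˡ-* (+ x) (+ a) ⟩
    -ᶻ + x *ᶻ + a            ∎
  e≡-yb : -ᶻ + (y * b) -ᶻ + 0 ≡ -ᶻ + y *ᶻ + b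
  e≡-yb = trans (ℤP.+-identityʳ _)
                (trans (cong -ᶻ_ (ℤP.pos-* y b)) (ℤP.neg-distribˡ-* (+ y) (+ b)))
... | Bézout.-+ x y 1+xa≡yb =
  + (y * b) , by-quotient (+ x) e-1≡xa , by-quotient (+ y) (trans (ℤP.+-identityʳ _) (ℤP.pos-* y b))
  where
  open ≡-Reasoning
  shift : ∀ p → + 1 +ᶻ p -ᶻ + 1 ≡ p
  shift = solve-∀
  e-1≡xa : + (y * b) -ᶻ + 1 ≡ + x *ᶻ + a
  e-1≡xa = begin
    + (y * b) -ᶻ + 1          ≡⟨ cong (λ t → + t -ᶻ + 1) 1+xa≡yb ⟨
    + (1 ℕ.+ x * a) -ᶻ + 1    ≡⟨ cong (_-ᶻ + 1) (ℤP.pos-+ 1 (x * a)) ⟩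
    + 1 +ᶻ + (x * a) -ᶻ + 1   ≡⟨ shift (+ (x * a)) ⟩
    + (x * a)                 ≡⟨ ℤP.pos-* x a ⟩
    + x *ᶻ + a                ∎

⟦_⟧ : ∀ {n} → Fin n → ℤ
⟦ r ⟧ = + toℕ r

reduce : ∀ n .{{_ : NonZero n}} → ℤ → Fin n
reduce n x = fromℕ< (ℤD.n%ℕd<d x n)

reduce-≈ : ∀ n .{{_ : NonZero n}} x → ⟦ reduce n x ⟧ ≈ x [mod n ]
reduce-≈ n x = by-quotient (-ᶻ (x ℤD./ℕ n)) (begin
    ⟦ reduce n x ⟧ -ᶻ x                  ≡⟨ cong (λ r → r -ᶻ x) (cong +_ (FinP.toℕ-fromℕ< _)) ⟩
    r -ᶻ x                               ≡⟨ cong (λ t → r -ᶻ t) (ℤD.a≡a%ℕn+[a/ℕn]*n x n) ⟩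
    r -ᶻ (r +ᶻ (x ℤD./ℕ n) *ᶻ + n)      ≡⟨ cancel r (x ℤD./ℕ n) (+ n) ⟩
    -ᶻ (x ℤD./ℕ n) *ᶻ + n               ∎)
  where
  open ≡-Reasoning
  r : ℤ
  r = + (x ℤD.%ℕ n)
  cancel : ∀ r q n → r -ᶻ (r +ᶻ q *ᶻ n) ≡ -ᶻ q *ᶻ n
  cancel = solve-∀

small-multiple≡0 : ∀ {n k} → n ℕD.∣ k → k ℕ.< n → k ≡ 0
small-multiple≡0 {k = ℕ.zero}  _   _   = refl
small-multiple≡0 {k = ℕ.suc k} n∣k k<n = ⊥-elim (ℕP.<⇒≱ k<n (ℕD.∣⇒≤ n∣k))

≈-canonical : ∀ {n} (r s : Fin n) → ⟦ r ⟧ ≈ ⟦ s ⟧ [mod n ] → r ≡ s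
≈-canonical {n} r s (mod-by n∣r-s) =
  FinP.toℕ-injective (ℤP.+-injective (ℤP.i-j≡0⇒i≡j _ _ (ℤP.∣i∣≡0⇒i≡0 |r-s|≡0)))
  where
  |r-s|<n : ∣ ⟦ r ⟧ -ᶻ ⟦ s ⟧ ∣ ℕ.< n
  |r-s|<n = ℕP.≤-<-trans
    (subst (ℕ._≤ toℕ r ℕ.⊔ toℕ s) (cong ∣_∣ (sym (ℤP.m-n≡m⊖n (toℕ r) (toℕ s))))
           (ℤP.∣m⊝n∣≤m⊔n (toℕ r) (toℕ s)))
    (ℕP.⊔-lub (FinP.toℕ<n r) (FinP.toℕ<n s))
  |r-s|≡0 : ∣ ⟦ r ⟧ -ᶻ ⟦ s ⟧ ∣ ≡ 0
  |r-s|≡0 = small-multiple≡0 (Signed.∣⇒∣ᵤ n∣r-s) |r-s|<n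

project : ∀ {N} n .{{_ : NonZero n}} → Fin N → Fin n
project n x = reduce n ⟦ x ⟧

infix 4 _≈ᵥ_[mod_]

_≈ᵥ_[mod_] : ∀ {N N' m} → Point N m → Point N' m → ℕ → Set
u ≈ᵥ v [mod k ] = Pointwise (λ x y → ⟦ x ⟧ ≈ ⟦ y ⟧ [mod k ]) u v

≈ᵥ-sym : ∀ {N N' m k} {u : Point N m} {v : Point N' m} → u ≈ᵥ v [mod k ] → v ≈ᵥ u [mod k ]
≈ᵥ-sym = Pointwise.sym ≈-sym

≈ᵥ-trans : ∀ {N N' N'' m k} {u : Point N m} {v : Point N' m} {w : Point N'' m} →
  u ≈ᵥ v [mod k ] → v ≈ᵥ w [mod k ] → u ≈ᵥ w [mod k ]
≈ᵥ-trans = Pointwise.trans ≈-trans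

≈ᵥ-combine : ∀ {N N' m a b} {u : Point N m} {v : Point N' m} → Coprime a b →
  u ≈ᵥ v [mod a ] → u ≈ᵥ v [mod b ] → u ≈ᵥ v [mod a * b ]
≈ᵥ-combine coprime []       []       = []
≈ᵥ-combine coprime (p ∷ ps) (q ∷ qs) = ≈-combine coprime p q ∷ ≈ᵥ-combine coprime ps qs

≈ᵥ-canonical : ∀ {n m} {u v : Point n m} → u ≈ᵥ v [mod n ] → u ≡ v
≈ᵥ-canonical = Pointwise-≡⇒≡ ∘ Pointwise.map (≈-canonical _ _)

sqDist-cong : ∀ {N N' m k} {u v : Point N m} {u' v' : Point N' m} →
  u ≈ᵥ u' [mod k ] → v ≈ᵥ v' [mod k ] → sqDist u v ≈ sqDist u' v' [mod k ]
sqDist-cong []       []       = ≈-refl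
sqDist-cong (p ∷ ps) (q ∷ qs) = ≈-+ (≈-* (≈-- p q) (≈-- p q)) (sqDist-cong ps qs)

sqDist-sym : ∀ {n m} (u v : Point n m) → sqDist u v ≡ sqDist v u
sqDist-sym []      []      = refl
sqDist-sym (x ∷ u) (y ∷ v) = cong₂ _+ᶻ_ (square-swap ⟦ x ⟧ ⟦ y ⟧) (sqDist-sym u v)
  where
  square-swap : ∀ x y → (x -ᶻ y) *ᶻ (x -ᶻ y) ≡ (y -ᶻ x) *ᶻ (y -ᶻ x)
  square-swap = solve-∀

sqDist-self : ∀ {n m} (u : Point n m) → sqDist u u ≡ + 0
sqDist-self []      = refl
sqDist-self (x ∷ u) = cong₂ _+ᶻ_ (square-zero ⟦ x ⟧) (sqDist-self u)
  where
  square-zero : ∀ x → (x -ᶻ x) *ᶻ (x -ᶻ x) ≡ + 0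
  square-zero = solve-∀

-- A point is at integral distance 0 from itself (this needs Z_n to have an element 0).
IntegralDist-refl : ∀ {n m} .{{_ : NonZero n}} (u : Point n m) → IntegralDist u u
IntegralDist-refl {n} u =
  zero , ≈⇒≡[mod] (≈-reflexive (trans (sqDist-self u) (sym (cong (λ t → t *ᶻ t) ⟦zero⟧))))
  where
  zero : Fin n
  zero = fromℕ< (ℕ.>-nonZero⁻¹ n)
  ⟦zero⟧ : ⟦ zero ⟧ ≡ + 0
  ⟦zero⟧ = cong +_ (FinP.toℕ-fromℕ< _)

IntegralDist-sym : ∀ {n m} (u v : Point n m) → IntegralDist u v → IntegralDist v u
IntegralDist-sym u v (d , p) = d , subst (_≡[mod _ ] _) (sqDist-sym u v) p

transfer-square : ∀ {N N' m k} {u v : Point N m} {u' v' : Point N' m} → k ℕD.∣ N →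
  ((d , _) : IntegralDist u v) → u' ≈ᵥ u [mod k ] → v' ≈ᵥ v [mod k ] →
  (d' : Fin N') → ⟦ d' ⟧ ≈ ⟦ d ⟧ [mod k ] → sqDist u' v' ≈ ⟦ d' ⟧ *ᶻ ⟦ d' ⟧ [mod k ]
transfer-square k∣N (d , integral) u'≈u v'≈v d' d'≈d =
  ≈-trans (sqDist-cong u'≈u v'≈v)
    (≈-trans (≈-weaken k∣N (≡[mod]⇒≈ integral)) (≈-sym (≈-* d'≈d d'≈d)))

projectPoint : ∀ {N m} n .{{_ : NonZero n}} → Point N m → Point n m
projectPoint n = Vec.map (project n)

projectPoint-≈ : ∀ {N m} n .{{_ : NonZero n}} (u : Point N m) → projectPoint n u ≈ᵥ u [mod n ]
projectPoint-≈ n []      = []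
projectPoint-≈ n (x ∷ u) = reduce-≈ n ⟦ x ⟧ ∷ projectPoint-≈ n u

projectPoint-integral : ∀ {N m} n .{{_ : NonZero n}} → n ℕD.∣ N → (u v : Point N m) →
  IntegralDist u v → IntegralDist (projectPoint n u) (projectPoint n v)
projectPoint-integral n n∣N u v dist@(d , _) = project n d , ≈⇒≡[mod]
  (transfer-square n∣N dist (projectPoint-≈ n u) (projectPoint-≈ n v) (project n d) (reduce-≈ n ⟦ d ⟧))

module ChineseRemainder (a b : ℕ) {{_ : NonZero a}} {{_ : NonZero b}} (coprime : Coprime a b) where

  instance
    ab≢0 : NonZero (a * b)
    ab≢0 = ℕP.m*n≢0 a b

  private
    eᵃ eᵇ : ℤ
    eᵃ = proj₁ (crt-idempotent coprime)
    eᵇ = proj₁ (crt-idempotent (Coprimality.sym coprime))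

    eᵃ≈1 : eᵃ ≈ + 1 [mod a ]
    eᵃ≈1 = proj₁ (proj₂ (crt-idempotent coprime))
    eᵃ≈0 : eᵃ ≈ + 0 [mod b ]
    eᵃ≈0 = proj₂ (proj₂ (crt-idempotent coprime))
    eᵇ≈1 : eᵇ ≈ + 1 [mod b ]
    eᵇ≈1 = proj₁ (proj₂ (crt-idempotent (Coprimality.sym coprime)))
    eᵇ≈0 : eᵇ ≈ + 0 [mod a ]
    eᵇ≈0 = proj₂ (proj₂ (crt-idempotent (Coprimality.sym coprime)))

    lift : Fin a → Fin b → ℤ
    lift x y = ⟦ x ⟧ *ᶻ eᵃ +ᶻ ⟦ y ⟧ *ᶻ eᵇ

  crt : Fin a → Fin b → Fin (a * b)
  crt x y = reduce (a * b) (lift x y)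

  crt-≈ˡ : ∀ x y → ⟦ crt x y ⟧ ≈ ⟦ x ⟧ [mod a ]
  crt-≈ˡ x y = begin
    ⟦ crt x y ⟧                    ≈⟨ ≈-weaken (ℕD.m∣m*n b) (reduce-≈ (a * b) (lift x y)) ⟩
    ⟦ x ⟧ *ᶻ eᵃ +ᶻ ⟦ y ⟧ *ᶻ eᵇ     ≈⟨ ≈-+ (≈-scale ⟦ x ⟧ eᵃ≈1) (≈-scale ⟦ y ⟧ eᵇ≈0) ⟩
    ⟦ x ⟧ *ᶻ + 1 +ᶻ ⟦ y ⟧ *ᶻ + 0   ≡⟨ simplify ⟦ x ⟧ ⟦ y ⟧ ⟩
    ⟦ x ⟧                          ∎
    where
    open ≈-Reasoning a
    simplify : ∀ x y → x *ᶻ + 1 +ᶻ y *ᶻ + 0 ≡ x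
    simplify = solve-∀

  crt-≈ʳ : ∀ x y → ⟦ crt x y ⟧ ≈ ⟦ y ⟧ [mod b ]
  crt-≈ʳ x y = begin
    ⟦ crt x y ⟧                    ≈⟨ ≈-weaken (ℕD.n∣m*n a) (reduce-≈ (a * b) (lift x y)) ⟩
    ⟦ x ⟧ *ᶻ eᵃ +ᶻ ⟦ y ⟧ *ᶻ eᵇ     ≈⟨ ≈-+ (≈-scale ⟦ x ⟧ eᵃ≈0) (≈-scale ⟦ y ⟧ eᵇ≈1) ⟩
    ⟦ x ⟧ *ᶻ + 0 +ᶻ ⟦ y ⟧ *ᶻ + 1   ≡⟨ simplify ⟦ x ⟧ ⟦ y ⟧ ⟩
    ⟦ y ⟧                          ∎
    where
    open ≈-Reasoning b
    simplify : ∀ x y → x *ᶻ + 0 +ᶻ y *ᶻ + 1 ≡ y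
    simplify = solve-∀

  crtPoint : ∀ {m} → Point a m → Point b m → Point (a * b) m
  crtPoint = zipWith crt

  crtPoint-≈ˡ : ∀ {m} (u : Point a m) (v : Point b m) → crtPoint u v ≈ᵥ u [mod a ]
  crtPoint-≈ˡ []      []      = []
  crtPoint-≈ˡ (x ∷ u) (y ∷ v) = crt-≈ˡ x y ∷ crtPoint-≈ˡ u v

  crtPoint-≈ʳ : ∀ {m} (u : Point a m) (v : Point b m) → crtPoint u v ≈ᵥ v [mod b ]
  crtPoint-≈ʳ []      []      = []
  crtPoint-≈ʳ (x ∷ u) (y ∷ v) = crt-≈ʳ x y ∷ crtPoint-≈ʳ u v

  projectPoint-crtˡ : ∀ {m} (u : Point a m) (v : Point b m) → projectPoint a (crtPoint u v) ≡ u
  projectPoint-crtˡ u v = ≈ᵥ-canonical (≈ᵥ-trans (projectPoint-≈ a (crtPoint u v)) (crtPoint-≈ˡ u v))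

  projectPoint-crtʳ : ∀ {m} (u : Point a m) (v : Point b m) → projectPoint b (crtPoint u v) ≡ v
  projectPoint-crtʳ u v = ≈ᵥ-canonical (≈ᵥ-trans (projectPoint-≈ b (crtPoint u v)) (crtPoint-≈ʳ u v))

  crtPoint-injective : ∀ {m} {u u' : Point a m} {v v' : Point b m} →
    crtPoint u v ≡ crtPoint u' v' → u ≡ u' × v ≡ v'
  crtPoint-injective {u = u} {u'} {v} {v'} eq =
    trans (sym (projectPoint-crtˡ u v)) (trans (cong (projectPoint a) eq) (projectPoint-crtˡ u' v')) ,
    trans (sym (projectPoint-crtʳ u v)) (trans (cong (projectPoint b) eq) (projectPoint-crtʳ u' v'))

  projections-injective : ∀ {m} {x y : Point (a * b) m} →
    (projectPoint a x , projectPoint b x) ≡ (projectPoint a y , projectPoint b y) → x ≡ y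
  projections-injective {x = x} {y} eq =
    ≈ᵥ-canonical (≈ᵥ-combine coprime (via a (cong proj₁ eq)) (via b (cong proj₂ eq)))
    where
    via : ∀ n .{{_ : NonZero n}} → projectPoint n x ≡ projectPoint n y → x ≈ᵥ y [mod n ]
    via n eqₙ = ≈ᵥ-trans (≈ᵥ-sym (projectPoint-≈ n x))
                  (subst (_≈ᵥ y [mod n ]) (sym eqₙ) (projectPoint-≈ n y))

  crtPoint-integral : ∀ {m} (u u' : Point a m) (v v' : Point b m) →
    IntegralDist u u' → IntegralDist v v' → IntegralDist (crtPoint u v) (crtPoint u' v')
  crtPoint-integral u u' v v' distᵃ@(d , _) distᵇ@(d' , _) = crt d d' , ≈⇒≡[mod]
    (≈-combine coprime
      (transfer-square ℕD.∣-refl distᵃ (crtPoint-≈ˡ u v) (crtPoint-≈ˡ u' v') (crt d d') (crt-≈ˡ d d'))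
      (transfer-square ℕD.∣-refl distᵇ (crtPoint-≈ʳ u v) (crtPoint-≈ʳ u' v') (crt d d') (crt-≈ʳ d d')))

module _ {A : Set} {R : A → A → Set} (R-refl : ∀ x → R x x) (R-sym : ∀ x y → R x y → R y x) where

  allPairs-members : ∀ {xs} → AllPairs R xs → ∀ {x y} → x ∈ xs → y ∈ xs → R x y
  allPairs-members (_  ∷ _)  (here refl) (here refl) = R-refl _
  allPairs-members (rs ∷ _)  (here refl) (there y∈)  = All.lookup rs y∈
  allPairs-members (rs ∷ _)  (there x∈)  (here refl) = R-sym _ _ (All.lookup rs x∈)
  allPairs-members (_  ∷ ps) (there x∈)  (there y∈)  = allPairs-members ps x∈ y∈

members-allPairs : ∀ {A : Set} {R : A → A → Set} {xs} →
  (∀ {x y} → x ∈ xs → y ∈ xs → R x y) → AllPairs R xs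
members-allPairs {xs = []}     related = []
members-allPairs {xs = _ ∷ _} related =
  All.tabulate (related (here refl) ∘ there) ∷ members-allPairs (λ x∈ y∈ → related (there x∈) (there y∈))

unique-length-≤ : ∀ {A : Set} {xs ys : List A} → Unique xs → (∀ {x} → x ∈ xs → x ∈ ys) →
  length xs ℕ.≤ length ys
unique-length-≤ {xs = []}     _          _   = ℕ.z≤n
unique-length-≤ {xs = x ∷ xs} (x∉ ∷ uniq) xs⊆ys with ∈-∃++ (xs⊆ys (here refl))
... | ps , qs , refl = subst (ℕ.suc (length xs) ℕ.≤_) (sym length-split)
                             (ℕ.s≤s (unique-length-≤ uniq xs⊆ps++qs))
  where
  xs⊆ps++qs : ∀ {y} → y ∈ xs → y ∈ ps ++ qs
  xs⊆ps++qs y∈ with ∈-++⁻ ps (xs⊆ys (there y∈))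
  ... | inj₁ y∈ps        = ∈-++⁺ˡ y∈ps
  ... | inj₂ (here y≡x)  = ⊥-elim (All.lookup x∉ y∈ (sym y≡x))
  ... | inj₂ (there y∈qs) = ∈-++⁺ʳ ps y∈qs
  length-split : length (ps ++ x ∷ qs) ≡ ℕ.suc (length (ps ++ qs))
  length-split = trans (ListP.length-++ ps)
    (trans (ℕP.+-suc (length ps) (length qs)) (cong ℕ.suc (sym (ListP.length-++ ps))))

length-cartesianProductWith : ∀ {A B C : Set} (f : A → B → C) xs ys →
  length (cartesianProductWith f xs ys) ≡ length xs * length ys
length-cartesianProductWith f []       ys = refl
length-cartesianProductWith f (x ∷ xs) ys =
  trans (ListP.length-++ (map (f x) ys))
        (cong₂ ℕ._+_ (ListP.length-map (f x) ys) (length-cartesianProductWith f xs ys))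

injection-bound : ∀ {A B C : Set} (f : A → B × C) → (∀ {x y} → f x ≡ f y → x ≡ y) →
  ∀ {xs P Q} → Unique xs → (∀ {x} → x ∈ xs → proj₁ (f x) ∈ P × proj₂ (f x) ∈ Q) →
  length xs ℕ.≤ length P * length Q
injection-bound f f-injective {xs} {P} {Q} uniq maps-into = begin
  length xs                     ≡⟨ ListP.length-map f xs ⟨
  length (map f xs)             ≤⟨ unique-length-≤ (Unique.map⁺ f-injective uniq) image⊆P×Q ⟩
  length (cartesianProduct P Q) ≡⟨ length-cartesianProductWith _,_ P Q ⟩
  length P * length Q           ∎
  where
  open ℕP.≤-Reasoning
  image⊆P×Q : ∀ {z} → z ∈ map f xs → z ∈ cartesianProduct P Q
  image⊆P×Q z∈ with ∈-map⁻ f z∈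
  ... | x , x∈ , refl = ∈-cartesianProduct⁺ (proj₁ (maps-into x∈)) (proj₂ (maps-into x∈))

_≟ₚ_ : ∀ {n m} → DecidableEquality (Point n m)
_≟ₚ_ = VecP.≡-dec FinP._≟_

ips-members : ∀ {n m S} .{{_ : NonZero n}} → IntegralPointSet n m S →
  ∀ {x y} → x ∈ S → y ∈ S → IntegralDist x y
ips-members (_ , pairs) = allPairs-members IntegralDist-refl IntegralDist-sym pairs

image : ∀ {N n m} (f : Point N m → Point n m) → List (Point N m) → List (Point n m)
image f S = deduplicate _≟ₚ_ (map f S)

image-∈ : ∀ {N n m} (f : Point N m → Point n m) {S x} → x ∈ S → f x ∈ image f S
image-∈ f x∈ = ∈-deduplicate⁺ _≟ₚ_ (∈-map⁺ f x∈)

image-ips : ∀ {N n m} .{{_ : NonZero N}} (f : Point N m → Point n m) →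
  (∀ x y → IntegralDist x y → IntegralDist (f x) (f y)) →
  ∀ {S} → IntegralPointSet N m S → IntegralPointSet n m (image f S)
image-ips f f-integral {S} ips = DecUnique.deduplicate-! _≟ₚ_ (map f S) , members-allPairs related
  where
  related : ∀ {x y} → x ∈ image f S → y ∈ image f S → IntegralDist x y
  related x∈ y∈ with ∈-map⁻ f (∈-deduplicate⁻ _≟ₚ_ (map f S) x∈)
                   | ∈-map⁻ f (∈-deduplicate⁻ _≟ₚ_ (map f S) y∈)
  ... | _ , x₀∈ , refl | _ , y₀∈ , refl = f-integral _ _ (ips-members ips x₀∈ y₀∈)

product-ips : ∀ {a b c m} .{{_ : NonZero a}} .{{_ : NonZero b}}
  (g : Point a m → Point b m → Point c m) →
  (∀ {u u' v v'} → g u v ≡ g u' v' → u ≡ u' × v ≡ v') →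
  (∀ u u' v v' → IntegralDist u u' → IntegralDist v v' → IntegralDist (g u v) (g u' v')) →
  ∀ {Sa Sb} → IntegralPointSet a m Sa → IntegralPointSet b m Sb →
  IntegralPointSet c m (cartesianProductWith g Sa Sb)
product-ips g g-injective g-integral {Sa} {Sb} ipsᵃ ipsᵇ =
  Unique.cartesianProductWith⁺ g g-injective (proj₁ ipsᵃ) (proj₁ ipsᵇ) , members-allPairs related
  where
  related : ∀ {x y} → x ∈ cartesianProductWith g Sa Sb → y ∈ cartesianProductWith g Sa Sb → IntegralDist x y
  related x∈ y∈ with ∈-cartesianProductWith⁻ g Sa Sb x∈ | ∈-cartesianProductWith⁻ g Sa Sb y∈
  ... | _ , _ , u∈ , v∈ , refl | _ , _ , u'∈ , v'∈ , refl =
    g-integral _ _ _ _ (ips-members ipsᵃ u∈ u'∈) (ips-members ipsᵇ v∈ v'∈)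

theorem3 : ∀ (a b m : ℕ) → NonZero a → NonZero b → NonZero m → Coprime a b →
    ∀ (ka kb : ℕ) → IsMaxIPS a m ka → IsMaxIPS b m kb → IsMaxIPS (a * b) m (ka * kb)
theorem3 a b m a≢0 b≢0 _ coprime ka kb ((Sa , ipsᵃ , |Sa|≡ka) , maxᵃ) ((Sb , ipsᵇ , |Sb|≡kb) , maxᵇ) =
  lower-bound , upper-bound
  where
  instance
    _ = a≢0
    _ = b≢0
  open ChineseRemainder a b coprime

  lower-bound : Σ (List (Point (a * b) m)) λ S → IntegralPointSet (a * b) m S × length S ≡ ka * kb
  lower-bound =
    cartesianProductWith crtPoint Sa Sb ,
    product-ips crtPoint crtPoint-injective crtPoint-integral ipsᵃ ipsᵇ ,
    trans (length-cartesianProductWith crtPoint Sa Sb) (cong₂ _*_ |Sa|≡ka |Sb|≡kb)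

  upper-bound : ∀ S → IntegralPointSet (a * b) m S → length S ℕ.≤ ka * kb
  upper-bound S ips = ℕP.≤-trans
    (injection-bound (λ x → projectPoint a x , projectPoint b x) projections-injective (proj₁ ips)
      (λ x∈ → image-∈ (projectPoint a) x∈ , image-∈ (projectPoint b) x∈))
    (ℕP.*-mono-≤ (maxᵃ _ (image-ips (projectPoint a) (projectPoint-integral a (ℕD.m∣m*n b)) ips))
                 (maxᵇ _ (image-ips (projectPoint b) (projectPoint-integral b (ℕD.n∣m*n a)) ips)))
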